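{- Let $k\ge1$ and let $(\boldsymbol{A},\boldsymbol{B},\boldsymbol{C},\boldsymbol{D})$ be an instance of $\mathsf{HPC}_k$ over universes of size $n$. Let $G(V,E,w)$ be the weighted directed graph constructed from it as in the context, and let $w^*$ be the weight of a minimum $s$-$t$ cut in $G$. Let $i^*$ be such that the pointer $z_k$ equals $x_{i^*}$ if $k$ is even and $y_{i^*}$ if $k$ is odd. Then $i^*=(w^* \bmod (n+1))+1$.
   Context: $\mathsf{HPC}_k$ instance: disjoint universes $\mathcal{X}=\{x_1,\dots,x_n\}$, $\mathcal{Y}=\{y_1,\dots,y_n\}$; for each $x\in\mathcal{X}$ sets $A_x,B_x\subseteq\mathcal{Y}$ with $A_x\cap B_x=\{t_x\}$; for each $y\in\mathcal{Y}$ sets $C_y,D_y\subseteq\mathcal{X}$ with $C_y\cap D_y=\{t_y\}$; pointers $z_0=x_1$, $z_1=t_{z_0}$, $z_2=t_{z_1}$, etc. Construction of $G$: vertices are $s$, $t$, and layers $V_0,\dots,V_k$ with $V_j=\{v^j_1,\dots,v^j_n\}$. Let $w_j=(n+1)^{k+1-j}$ for $0\le j\le k$. Edges (directed, parallel edges kept, weights added for cut value): $(s,v^0_1)$ of weight $w_0$; for each $0<j\le k$ and $i\in[n]$, $(v^j_i,t)$ of weight $w_j$; for each $i\in[n]$, an additional edge $(v^k_i,t)$ of weight $i-1$; for every even $0\le j<k$ and $i,i'\in[n]$, an edge $(v^j_i,v^{j+1}_{i'})$ of weight $w_{j+1}$ if $y_{i'}\in A_{x_i}$ and another such edge if $y_{i'}\in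 B_{x_i}$; for every odd $0<j<k$ and $i,i'\in[n]$, an edge $(v^j_i,v^{j+1}_{i'})$ of weight $w_{j+1}$ if $x_{i'}\in C_{y_i}$ and another if $x_{i'}\in D_{y_i}$. The weight of an $s$-$t$ cut is the total weight of edges from the $s$ side to the $t$ side. -}

module Defs where

open import Data.Nat using (ℕ; zero; suc; _+_; _*_; _∸_; _^_; _≤_)
open import Data.Bool using (Bool; true; false; if_then_else_; _∧_; not)
open import Data.Fin using (Fin; toℕ; inject₁) renaming (zero to fzero; suc to fsuc)
open import Data.Fin.Subset using (Subset; _∩_; ⁅_⁆)
open import Data.Fin.Subset.Properties using (_∈?_)
open import Data.List using (List; []; _∷_; _++_; concatMap; map; allFin)
open import Data.Nat.ListAction using (sum)
open import Data.Product using (Σ; _×_; _,_)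
open import Relation.Nullary using (does)
open import Relation.Binary.PropositionalEquality using (_≡_)

record WEdge (V : Set) : Set where
  constructor edge
  field
    from   : V
    to     : V
    weight : ℕ

open WEdge public

-- A weighted directed multigraph on vertex type V, given as a list of
-- edges (parallel edges are kept as separate list entries).
WGraph : Set → Set
WGraph V = List (WEdge V)

record Cut (V : Set) (s t : V) : Set where
  field
    side   : V → Bool
    s-side : side s ≡ true
    t-side : side t ≡ false

open Cut public

cutWeight : {V : Set} {s t : V} → WGraph V → Cut V s t → ℕ
cutWeight G S =
  sum (map (λ e → if side S (from e) ∧ not (side S (to e)) then weight e else 0) G)

IsMinCutWeight : {V : Set} → WGraph V → (s t : V) → ℕ → Set
IsMinCutWeight {V} G s t w =
  Σ (Cut V s t) (λ S → cutWeight G S ≡ w) × ((S : Cut V s t) → w ≤ cutWeight G S)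

-- HPC_k instances. Universes X = {x_1..x_n}, Y = {y_1..y_n} are both
-- represented by Fin n (x_i / y_i ↦ i - 1).

record HPC (n : ℕ) : Set where
  field
    A B : Fin n → Subset n      -- A_x, B_x ⊆ Y
    C D : Fin n → Subset n      -- C_y, D_y ⊆ X
    tX  : Fin n → Fin n          -- t_x ∈ Y
    tY  : Fin n → Fin n          -- t_y ∈ X
    AB∩ : ∀ x → A x ∩ B x ≡ ⁅ tX x ⁆
    CD∩ : ∀ y → C y ∩ D y ≡ ⁅ tY y ⁆

isEven : ℕ → Bool
isEven zero = true
isEven (suc j) = not (isEven j)

-- pointers: z_0 = x_1, z_{j+1} = t_{z_j}; z_j ∈ X for even j, ∈ Y for odd j
pointer : {n : ℕ} → HPC (suc n) → ℕ → Fin (suc n)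
pointer I zero = fzero
pointer I (suc j) =
  if isEven j then HPC.tX I (pointer I j) else HPC.tY I (pointer I j)

data Vtx (k n : ℕ) : Set where
  s t : Vtx k n
  v   : Fin (suc k) → Fin n → Vtx k n   -- v j i = v^j_{i+1}

wt : (k n j : ℕ) → ℕ
wt k n j = (n + 1) ^ (k + 1 ∸ j)

if∈ : {n : ℕ} {E : Set} → Fin n → Subset n → E → List E
if∈ i P e = if does (i ∈? P) then e ∷ [] else []

layerEdges : {n : ℕ} (k : ℕ) → HPC n → Fin k → List (WEdge (Vtx k n))
layerEdges {n} k I j =
  concatMap (λ i → concatMap (λ i' →
    let e = edge (v (inject₁ j) i) (v (fsuc j) i') (wt k n (suc (toℕ j))) in
    if isEven (toℕ j)
      then if∈ i' (HPC.A I i) e ++ if∈ i' (HPC.B I i) e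
      else if∈ i' (HPC.C I i) e ++ if∈ i' (HPC.D I i) e)
    (allFin n)) (allFin n)

graph : (k n : ℕ) → HPC (suc n) → WGraph (Vtx k (suc n))
graph k n I =
     edge s (v fzero fzero) (wt k N 0)
   ∷ concatMap (λ j → map (λ i → edge (v (fsuc j) i) t (wt k N (suc (toℕ j)))) (allFin N)) (allFin k)
  ++ map (λ i → edge (v (Data.Fin.fromℕ k) i) t (toℕ i)) (allFin N)
  ++ concatMap (layerEdges k I) (allFin k)
  where N = suc n

module Submission where

-- Let z_0, …, z_k be the
-- pointer path and m_j = |P ∪ Q| for the two out-sets P, Q of z_j (so P ∩ Q = {z_{j+1}}).
-- Writing B = N + 1 for the universe size N (= suc n below), the minimum cut weight is
-- the base-B number with digits m_0 … m_{k-1} and last digit the index of z_k: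
--     w* = ∑_{j<k} B^(k-j) · m_j + index(z_k),
-- so w* mod B recovers z_k.  The proof has two halves.
--   * Upper bound: the canonical cut whose s side is {s, z_0, …, z_k} has exactly this
--     weight (vertexCost-canonical, stage-canonical, lastCost-canonical).
--   * Lower bound: in any cut, a stage j whose z_j is on the s side pays at least
--     B^(k-j) · (m_j + [z_{j+1} on the t side]), since z_{j+1} receives two parallel
--     edges (stage-lower); the arithmetic path-cost lemma turns these local bounds into
--     the global one, because digits are < B and leaving the path costs a whole unit.

open import Data.Bool using (Bool; true; false; if_then_else_; _∧_; _∨_; not)
open import Data.Fin using (Fin; toℕ; inject₁; fromℕ) renaming (zero to fzero; suc to fsuc)
open import Data.Fin.Properties using (toℕ-inject₁; toℕ-fromℕ; toℕ<n) renaming (suc-injective to fsuc-injective; _≟_ to _≟ᶠ_)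
open import Data.Fin.Subset using (Subset; _∩_; ⁅_⁆; _∈_)
open import Data.Fin.Subset.Properties using (_∈?_; x∈p∩q⁻; x∈p∩q⁺; x∈⁅x⁆; x∈⁅y⁆⇒x≡y)
open import Data.List using (List; []; _∷_; _++_; concatMap; map; tabulate; allFin)
open import Data.List.Properties using (map-++; map-tabulate)
open import Data.Nat using (ℕ; zero; suc; _≤_; _<_; _+_; _*_; _∸_; _^_; _%_; z≤n; s≤s; NonZero)
open import Data.Nat.DivMod using ([m+kn]%n≡m%n; m≤n⇒m%n≡m)
open import Data.Nat.ListAction using (sum)
open import Data.Nat.ListAction.Properties using (sum-++)
open import Data.Nat.Properties
open import Data.Product using (_,_; proj₁; proj₂)
open import Function using (_∘_; _$_)
open import Relation.Binary.PropositionalEquality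
open import Relation.Nullary using (does; yes; no)
open import Relation.Nullary.Decidable using (dec-true; dec-false)
open import Relation.Nullary.Negation using (contradiction)

open import Defs

open import Algebra.Properties.Semiring.Sum +-*-semiring
  using (sum-syntax; sum-cong-≗; ∑-distrib-+; *-distribˡ-sum)
  renaming (sum to ∑)

bit : Bool → ℕ
bit b = if b then 1 else 0

bit≤1 : ∀ b → bit b ≤ 1
bit≤1 true  = s≤s z≤n
bit≤1 false = z≤n

∑-pick : ∀ {n} (f : Fin n → ℕ) i → f i ≤ ∑ f
∑-pick f fzero    = m≤m+n (f fzero) _
∑-pick f (fsuc i) = ≤-trans (∑-pick (f ∘ fsuc) i) (m≤n+m _ (f fzero))

∑-zero : ∀ {n} {f : Fin n → ℕ} → (∀ i → f i ≡ 0) → ∑ f ≡ 0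
∑-zero {zero}  zeros = refl
∑-zero {suc n} zeros = cong₂ _+_ (zeros fzero) (∑-zero (zeros ∘ fsuc))

∑-single : ∀ {n} (f : Fin n → ℕ) i → (∀ j → j ≢ i → f j ≡ 0) → ∑ f ≡ f i
∑-single {suc n} f fzero vanish =
  trans (cong (f fzero +_) (∑-zero (λ j → vanish (fsuc j) λ ()))) (+-identityʳ (f fzero))
∑-single {suc n} f (fsuc i) vanish =
  cong₂ _+_ (vanish fzero λ ())
            (∑-single (f ∘ fsuc) i λ j j≢i → vanish (fsuc j) (j≢i ∘ fsuc-injective))

∑-mono : ∀ {n} {f g : Fin n → ℕ} → (∀ i → f i ≤ g i) → ∑ f ≤ ∑ g
∑-mono {zero}  f≤g = z≤n
∑-mono {suc n} f≤g = +-mono-≤ (f≤g fzero) (∑-mono (f≤g ∘ fsuc))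

∑-bits : ∀ {n} (f : Fin n → Bool) → ∑ (bit ∘ f) ≤ n
∑-bits {zero}  f = z≤n
∑-bits {suc n} f = +-mono-≤ (bit≤1 (f fzero)) (∑-bits (f ∘ fsuc))

listSum : {A : Set} → (A → ℕ) → List A → ℕ
listSum f xs = sum (map f xs)

listSum-++ : {A : Set} (f : A → ℕ) (xs ys : List A) →
  listSum f (xs ++ ys) ≡ listSum f xs + listSum f ys
listSum-++ f xs ys = trans (cong sum (map-++ f xs ys)) (sum-++ (map f xs) (map f ys))

listSum-concatMap : {A B : Set} (f : B → ℕ) (g : A → List B) (xs : List A) →
  listSum f (concatMap g xs) ≡ listSum (listSum f ∘ g) xs
listSum-concatMap f g []       = refl
listSum-concatMap f g (x ∷ xs) =
  trans (listSum-++ f (g x) (concatMap g xs)) (cong (listSum f (g x) +_) (listSum-concatMap f g xs))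

listSum-tabulate : ∀ {A : Set} {n} (f : A → ℕ) (g : Fin n → A) → listSum f (tabulate g) ≡ ∑ (f ∘ g)
listSum-tabulate {n = zero}  f g = refl
listSum-tabulate {n = suc n} f g = cong (f (g fzero) +_) (listSum-tabulate f (g ∘ fsuc))

listSum-map-allFin : ∀ {A : Set} {n} (f : A → ℕ) (g : Fin n → A) →
  listSum f (map g (allFin n)) ≡ ∑[ i < n ] f (g i)
listSum-map-allFin f g = trans (cong (listSum f) (map-tabulate (λ i → i) g)) (listSum-tabulate f g)

listSum-concatMap-allFin : ∀ {A : Set} {n} (f : A → ℕ) (g : Fin n → List A) →
  listSum f (concatMap g (allFin n)) ≡ ∑[ i < n ] listSum f (g i)
listSum-concatMap-allFin f g = trans (listSum-concatMap f g (allFin _)) (listSum-tabulate (listSum f ∘ g) (λ i → i))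

positional : (B : ℕ) {K : ℕ} → (Fin K → ℕ) → ℕ → ℕ
positional B {zero}  d z = z
positional B {suc K} d z = B ^ suc K * d fzero + positional B (d ∘ fsuc) z

positional-∑ : ∀ B {K} (d : Fin K → ℕ) z → ∑[ j < K ] (B ^ (K ∸ toℕ j) * d j) + z ≡ positional B d z
positional-∑ B {zero}  d z = refl
positional-∑ B {suc K} d z =
  trans (+-assoc (B ^ suc K * d fzero) _ z) (cong (B ^ suc K * d fzero +_) (positional-∑ B (d ∘ fsuc) z))

positional-mod : ∀ B .{{_ : NonZero B}} {K} (d : Fin K → ℕ) z → positional B d z % B ≡ z % B
positional-mod B {zero}  d z = refl
positional-mod B {suc K} d z = begin
  (B ^ suc K * d fzero + rest) % B  ≡⟨ cong (_% B) (+-comm (B ^ suc K * d fzero) rest) ⟩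
  (rest + B ^ suc K * d fzero) % B  ≡⟨ cong (λ x → (rest + x) % B) leading ⟩
  (rest + B ^ K * d fzero * B) % B  ≡⟨ [m+kn]%n≡m%n rest (B ^ K * d fzero) B ⟩
  rest % B                          ≡⟨ positional-mod B (d ∘ fsuc) z ⟩
  z % B                             ∎
  where
  open ≡-Reasoning
  rest = positional B (d ∘ fsuc) z
  leading : B ^ suc K * d fzero ≡ B ^ K * d fzero * B
  leading = trans (*-assoc B (B ^ K) (d fzero)) (*-comm B (B ^ K * d fzero))

positional-< : ∀ b {K} (d : Fin K → ℕ) z → (∀ j → d j ≤ b) → z ≤ b → positional (suc b) d z < suc b ^ suc K
positional-< b {zero}  d z d≤b z≤b = subst (z <_) (sym (*-identityʳ (suc b))) (s≤s z≤b)
positional-< b {suc K} d z d≤b z≤b = begin-strict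
  P * d fzero + positional (suc b) (d ∘ fsuc) z  <⟨ +-monoʳ-< (P * d fzero) (positional-< b (d ∘ fsuc) z (d≤b ∘ fsuc) z≤b) ⟩
  P * d fzero + P                                ≡⟨ trans (+-comm (P * d fzero) P) (sym (*-suc P (d fzero))) ⟩
  P * suc (d fzero)                              ≤⟨ *-monoʳ-≤ P (s≤s (d≤b fzero)) ⟩
  P * suc b                                      ≡⟨ *-comm P (suc b) ⟩
  suc b * P                                      ∎
  where
  open ≤-Reasoning
  P = suc b ^ suc K

-- Since the digits are ≤ b, abandoning the path at stage j costs a full
-- unit (suc b)^(K-j), more than all later digits together; so the total cost is at
-- least the positional value of the digits.
path-cost : ∀ b {K} (d T : Fin K → ℕ) (r : Fin (suc K) → Bool) (z X : ℕ) →
  (∀ j → d j ≤ b) → z ≤ b →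
  (∀ j → r (inject₁ j) ≡ true → suc b ^ (K ∸ toℕ j) * (d j + bit (not (r (fsuc j)))) ≤ T j) →
  (r (fromℕ K) ≡ true → z ≤ X) →
  r fzero ≡ true →
  positional (suc b) d z ≤ ∑ T + X
path-cost b {zero} d T r z X d≤b z≤b stage last r₀ = last r₀
path-cost b {suc K} d T r z X d≤b z≤b stage last r₀
  with r (fsuc fzero) in r₁ | stage fzero r₀
... | true | first = begin
  P * d fzero + positional (suc b) (d ∘ fsuc) z
    ≤⟨ +-mono-≤ (subst (λ x → P * x ≤ T fzero) (+-identityʳ (d fzero)) first)
                (path-cost b (d ∘ fsuc) (T ∘ fsuc) (r ∘ fsuc) z X (d≤b ∘ fsuc) z≤b (stage ∘ fsuc) last r₁) ⟩
  T fzero + (∑ (T ∘ fsuc) + X)  ≡⟨ +-assoc (T fzero) _ X ⟨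
  ∑ T + X                       ∎
  where
  open ≤-Reasoning
  P = suc b ^ suc K
... | false | first = begin
  P * d fzero + positional (suc b) (d ∘ fsuc) z
    ≤⟨ +-monoʳ-≤ (P * d fzero) (<⇒≤ (positional-< b (d ∘ fsuc) z (d≤b ∘ fsuc) z≤b)) ⟩
  P * d fzero + P   ≡⟨ trans (*-distribˡ-+ P (d fzero) 1) (cong (P * d fzero +_) (*-identityʳ P)) ⟨
  P * (d fzero + 1) ≤⟨ first ⟩
  T fzero           ≤⟨ m≤m+n (T fzero) _ ⟩
  ∑ T               ≤⟨ m≤m+n (∑ T) X ⟩
  ∑ T + X           ∎
  where
  open ≤-Reasoning
  P = suc b ^ suc K

_∈ᵇ_ : ∀ {N} → Fin N → Subset N → Bool
i ∈ᵇ P = does (i ∈? P)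

multiplicity : ∀ {N} → Subset N → Subset N → Fin N → ℕ
multiplicity P Q i = bit (i ∈ᵇ P) + bit (i ∈ᵇ Q)

covered : ∀ {N} → Subset N → Subset N → Fin N → ℕ
covered P Q i = bit (i ∈ᵇ P ∨ i ∈ᵇ Q)

module TwoSetsMeetingInOnePoint {N} {P Q : Subset N} {t : Fin N} (P∩Q : P ∩ Q ≡ ⁅ t ⁆) where

  private
    target∈P∩Q : t ∈ P ∩ Q
    target∈P∩Q = subst (t ∈_) (sym P∩Q) (x∈⁅x⁆ t)

  multiplicity-target : multiplicity P Q t ≡ 2
  multiplicity-target
    rewrite dec-true (t ∈? P) (proj₁ (x∈p∩q⁻ P Q target∈P∩Q))
          | dec-true (t ∈? Q) (proj₂ (x∈p∩q⁻ P Q target∈P∩Q)) = refl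

  covered-target : covered P Q t ≡ 1
  covered-target rewrite dec-true (t ∈? P) (proj₁ (x∈p∩q⁻ P Q target∈P∩Q)) = refl

  multiplicity-off-target : ∀ i → i ≢ t → multiplicity P Q i ≡ covered P Q i
  multiplicity-off-target i i≢t with i ∈? P | i ∈? Q
  ... | yes i∈P | yes i∈Q = contradiction (x∈⁅y⁆⇒x≡y t (subst (i ∈_) P∩Q (x∈p∩q⁺ (i∈P , i∈Q)))) i≢t
  ... | yes _   | no _    = refl
  ... | no _    | yes _   = refl
  ... | no _    | no _    = refl

listSum-if∈ : ∀ {N} {E : Set} (f : E → ℕ) (i : Fin N) (P : Subset N) (e : E) →
  listSum f (if∈ i P e) ≡ bit (i ∈ᵇ P) * f e
listSum-if∈ f i P e with i ∈ᵇ P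
... | true  = trans (+-identityʳ (f e)) (sym (*-identityˡ (f e)))
... | false = refl

listSum-parallel : ∀ {N} {E : Set} (f : E → ℕ) (i : Fin N) (P Q : Subset N) (e : E) →
  listSum f (if∈ i P e ++ if∈ i Q e) ≡ multiplicity P Q i * f e
listSum-parallel f i P Q e = begin
  listSum f (if∈ i P e ++ if∈ i Q e)         ≡⟨ listSum-++ f (if∈ i P e) (if∈ i Q e) ⟩
  listSum f (if∈ i P e) + listSum f (if∈ i Q e) ≡⟨ cong₂ _+_ (listSum-if∈ f i P e) (listSum-if∈ f i Q e) ⟩
  bit (i ∈ᵇ P) * f e + bit (i ∈ᵇ Q) * f e       ≡⟨ *-distribʳ-+ (f e) (bit (i ∈ᵇ P)) _ ⟨
  multiplicity P Q i * f e                     ∎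
  where open ≡-Reasoning

crossing : {V : Set} → (V → Bool) → WEdge V → ℕ
crossing σ e = if σ (from e) ∧ not (σ (to e)) then weight e else 0

listSum-layerPair : ∀ {N} {E : Set} (f : E → ℕ) (even : Bool) (P Q P′ Q′ : Subset N) (i : Fin N) (e : E) →
  listSum f (if even then if∈ i P e ++ if∈ i Q e else if∈ i P′ e ++ if∈ i Q′ e)
    ≡ multiplicity (if even then P else P′) (if even then Q else Q′) i * f e
listSum-layerPair f true  P Q P′ Q′ i e = listSum-parallel f i P Q e
listSum-layerPair f false P Q P′ Q′ i e = listSum-parallel f i P′ Q′ e

-- A vertex kept on the s side pays its sink edge w, at least w times its covering bit.
sink-pays : ∀ w c m → w * (bit c + 0) ≤ w + m * 0
sink-pays w c m = begin
  w * (bit c + 0) ≡⟨ cong (w *_) (+-identityʳ (bit c)) ⟩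
  w * bit c       ≤⟨ *-monoʳ-≤ w (bit≤1 c) ⟩
  w * 1           ≡⟨ *-identityʳ w ⟩
  w               ≤⟨ m≤m+n w (m * 0) ⟩
  w + m * 0       ∎
  where open ≤-Reasoning

module Cuts (k n : ℕ) (I : HPC (suc n)) where

  N : ℕ
  N = suc n

  B : ℕ
  B = suc n + 1

  layerWeight : ∀ j → wt k N (suc j) ≡ B ^ (k ∸ j)
  layerWeight j rewrite +-comm k 1 = refl

  sourceWeight : wt k N 0 ≡ B ^ suc k
  sourceWeight rewrite +-comm k 1 = refl

  Out₁ Out₂ : Fin k → Fin N → Subset N
  Out₁ j i = if isEven (toℕ j) then HPC.A I i else HPC.C I i
  Out₂ j i = if isEven (toℕ j) then HPC.B I i else HPC.D I i

  target : Fin k → Fin N → Fin N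
  target j i = if isEven (toℕ j) then HPC.tX I i else HPC.tY I i

  Out∩ : ∀ j i → Out₁ j i ∩ Out₂ j i ≡ ⁅ target j i ⁆
  Out∩ j i with isEven (toℕ j)
  ... | true  = HPC.AB∩ I i
  ... | false = HPC.CD∩ I i

  sourceEdge : WEdge (Vtx k N)
  sourceEdge = edge s (v fzero fzero) (wt k N 0)

  sinkEdge : Fin k → Fin N → WEdge (Vtx k N)
  sinkEdge j i = edge (v (fsuc j) i) t (wt k N (suc (toℕ j)))

  lastEdge : Fin N → WEdge (Vtx k N)
  lastEdge i = edge (v (fromℕ k) i) t (toℕ i)

  layerEdge : Fin k → Fin N → Fin N → WEdge (Vtx k N)
  layerEdge j i i′ = edge (v (inject₁ j) i) (v (fsuc j) i′) (wt k N (suc (toℕ j)))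

  module _ (σ : Vtx k N → Bool) where

    sinkCost : Fin k → ℕ
    sinkCost j = ∑[ i < N ] crossing σ (sinkEdge j i)

    rowCost : Fin k → Fin N → ℕ
    rowCost j i = ∑[ i′ < N ] (multiplicity (Out₁ j i) (Out₂ j i) i′ * crossing σ (layerEdge j i i′))

    stageCost : Fin k → ℕ
    stageCost j = sinkCost j + ∑[ i < N ] rowCost j i

    lastCost : ℕ
    lastCost = ∑[ i < N ] crossing σ (lastEdge i)

    vertexCost : Fin k → Fin N → Fin N → ℕ
    vertexCost j i i′ = crossing σ (sinkEdge j i′) + multiplicity (Out₁ j i) (Out₂ j i) i′ * crossing σ (layerEdge j i i′)

    sinkCost+rowCost : ∀ j i → sinkCost j + rowCost j i ≡ ∑[ i′ < N ] vertexCost j i i′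
    sinkCost+rowCost j i =
      sym (∑-distrib-+ (crossing σ ∘ sinkEdge j)
                       (λ i′ → multiplicity (Out₁ j i) (Out₂ j i) i′ * crossing σ (layerEdge j i i′)))

  pairEdges : Fin k → Fin N → Fin N → List (WEdge (Vtx k N))
  pairEdges j i i′ =
    if isEven (toℕ j)
      then if∈ i′ (HPC.A I i) (layerEdge j i i′) ++ if∈ i′ (HPC.B I i) (layerEdge j i i′)
      else if∈ i′ (HPC.C I i) (layerEdge j i i′) ++ if∈ i′ (HPC.D I i) (layerEdge j i i′)

  layerEdges-weight : ∀ σ j → listSum (crossing σ) (layerEdges k I j) ≡ ∑[ i < N ] rowCost σ j i
  layerEdges-weight σ j =
    trans (listSum-concatMap-allFin (crossing σ) (λ i → concatMap (pairEdges j i) (allFin N))) (sum-cong-≗ λ i →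
    trans (listSum-concatMap-allFin (crossing σ) (pairEdges j i)) (sum-cong-≗ λ i′ →
      listSum-layerPair (crossing σ) (isEven (toℕ j)) (HPC.A I i) (HPC.B I i) (HPC.C I i) (HPC.D I i) i′
                        (layerEdge j i i′)))

  cutWeight-decomposition : (S : Cut (Vtx k N) s t) → let σ = side S in
    cutWeight (graph k n I) S ≡ crossing σ sourceEdge + (∑[ j < k ] stageCost σ j + lastCost σ)
  cutWeight-decomposition S = cong (crossing σ sourceEdge +_) (begin
    listSum (crossing σ) (sinks ++ lasts ++ layers)
      ≡⟨ listSum-++ (crossing σ) sinks (lasts ++ layers) ⟩
    listSum (crossing σ) sinks + listSum (crossing σ) (lasts ++ layers)
      ≡⟨ cong (listSum (crossing σ) sinks +_) (listSum-++ (crossing σ) lasts layers) ⟩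
    listSum (crossing σ) sinks + (listSum (crossing σ) lasts + listSum (crossing σ) layers)
      ≡⟨ cong₂ _+_ sinks-weight (cong₂ _+_ lasts-weight layers-weight) ⟩
    ∑ (sinkCost σ) + (lastCost σ + ∑ layerCost)
      ≡⟨ cong (∑ (sinkCost σ) +_) (+-comm (lastCost σ) (∑ layerCost)) ⟩
    ∑ (sinkCost σ) + (∑ layerCost + lastCost σ)
      ≡⟨ +-assoc (∑ (sinkCost σ)) (∑ layerCost) (lastCost σ) ⟨
    ∑ (sinkCost σ) + ∑ layerCost + lastCost σ
      ≡⟨ cong (_+ lastCost σ) (∑-distrib-+ (sinkCost σ) layerCost) ⟨
    ∑[ j < k ] stageCost σ j + lastCost σ ∎)
    where
    open ≡-Reasoning
    σ = side S
    sinks = concatMap (λ j → map (sinkEdge j) (allFin N)) (allFin k)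
    lasts = map lastEdge (allFin N)
    layers = concatMap (layerEdges k I) (allFin k)
    sinks-weight : listSum (crossing σ) sinks ≡ ∑ (sinkCost σ)
    sinks-weight = trans (listSum-concatMap-allFin (crossing σ) (λ j → map (sinkEdge j) (allFin N))) (sum-cong-≗ λ j →
                     listSum-map-allFin (crossing σ) (sinkEdge j))
    lasts-weight : listSum (crossing σ) lasts ≡ lastCost σ
    lasts-weight = listSum-map-allFin (crossing σ) lastEdge
    layerCost : Fin k → ℕ
    layerCost j = ∑[ i < N ] rowCost σ j i
    layers-weight : listSum (crossing σ) layers ≡ ∑ layerCost
    layers-weight = trans (listSum-concatMap-allFin (crossing σ) (layerEdges k I)) (sum-cong-≗ (layerEdges-weight σ))

  pathVertex : Fin (suc k) → Vtx k N
  pathVertex j = v j (pointer I (toℕ j))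

  digit : Fin k → ℕ
  digit j = ∑[ i′ < N ] covered (Out₁ j (pointer I (toℕ j))) (Out₂ j (pointer I (toℕ j))) i′

  digit≤ : ∀ j → digit j ≤ n + 1
  digit≤ j = ≤-trans (∑-bits (λ i′ → i′ ∈ᵇ Out₁ j z ∨ i′ ∈ᵇ Out₂ j z)) (≤-reflexive (+-comm 1 n))
    where z = pointer I (toℕ j)

  lastDigit≤ : toℕ (pointer I k) ≤ n + 1
  lastDigit≤ = ≤-trans (<⇒≤ (toℕ<n (pointer I k))) (≤-reflexive (+-comm 1 n))

  minWeight : ℕ
  minWeight = positional B digit (toℕ (pointer I k))

  vertexCost-lower : ∀ σ j i i′ → σ t ≡ false → σ (v (inject₁ j) i) ≡ true →
    wt k N (suc (toℕ j)) * (covered (Out₁ j i) (Out₂ j i) i′ + bit (does (i′ ≟ᶠ target j i) ∧ not (σ (v (fsuc j) i′))))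
      ≤ vertexCost σ j i i′
  vertexCost-lower σ j i i′ σt σi rewrite σt | σi with σ (v (fsuc j) i′) | i′ ≟ᶠ target j i
  ... | true  | yes _ = sink-pays (wt k N (suc (toℕ j))) _ (multiplicity (Out₁ j i) (Out₂ j i) i′)
  ... | true  | no _  = sink-pays (wt k N (suc (toℕ j))) _ (multiplicity (Out₁ j i) (Out₂ j i) i′)
  ... | false | yes refl
      rewrite TwoSetsMeetingInOnePoint.covered-target (Out∩ j i)
            | TwoSetsMeetingInOnePoint.multiplicity-target (Out∩ j i) = ≤-reflexive (*-comm w 2)
    where w = wt k N (suc (toℕ j))
  ... | false | no i′≢t
      rewrite TwoSetsMeetingInOnePoint.multiplicity-off-target (Out∩ j i) i′ i′≢t
            | +-identityʳ (covered (Out₁ j i) (Out₂ j i) i′) = ≤-reflexive (*-comm w _)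
    where w = wt k N (suc (toℕ j))

  stage-lower : ∀ σ j → σ t ≡ false → σ (pathVertex (inject₁ j)) ≡ true →
    B ^ (k ∸ toℕ j) * (digit j + bit (not (σ (pathVertex (fsuc j))))) ≤ stageCost σ j
  stage-lower σ j σt reached = begin
    B ^ (k ∸ toℕ j) * (digit j + bit (not (σ (v (fsuc j) z′))))
      ≡⟨ cong₂ (λ u b → u * (digit j + b)) (layerWeight (toℕ j)) missed-target ⟨
    w * (digit j + missed z′)                 ≤⟨ *-monoʳ-≤ w (+-monoʳ-≤ (digit j) (∑-pick missed z′)) ⟩
    w * (digit j + ∑ missed)                  ≡⟨ cong (w *_) (∑-distrib-+ cov missed) ⟨
    w * ∑[ i′ < N ] (cov i′ + missed i′)      ≡⟨ *-distribˡ-sum w (λ i′ → cov i′ + missed i′) ⟩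
    ∑[ i′ < N ] (w * (cov i′ + missed i′))    ≤⟨ ∑-mono (λ i′ → vertexCost-lower σ j z i′ σt reached′) ⟩
    ∑[ i′ < N ] vertexCost σ j z i′           ≡⟨ sinkCost+rowCost σ j z ⟨
    sinkCost σ j + rowCost σ j z              ≤⟨ +-monoʳ-≤ (sinkCost σ j) (∑-pick (rowCost σ j) z) ⟩
    stageCost σ j                             ∎
    where
    open ≤-Reasoning
    z = pointer I (toℕ j)
    z′ = target j z
    w = wt k N (suc (toℕ j))
    cov : Fin N → ℕ
    cov = covered (Out₁ j z) (Out₂ j z)
    missed : Fin N → ℕ
    missed i′ = bit (does (i′ ≟ᶠ z′) ∧ not (σ (v (fsuc j) i′)))
    missed-target : missed z′ ≡ bit (not (σ (v (fsuc j) z′)))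
    missed-target rewrite dec-true (z′ ≟ᶠ z′) refl = refl
    reached′ : σ (v (inject₁ j) z) ≡ true
    reached′ = subst (λ q → σ (v (inject₁ j) (pointer I q)) ≡ true) (toℕ-inject₁ j) reached

  lastCost-lower : ∀ σ → σ t ≡ false → σ (pathVertex (fromℕ k)) ≡ true → toℕ (pointer I k) ≤ lastCost σ
  lastCost-lower σ σt reached =
    subst (_≤ lastCost σ) (cong (toℕ ∘ pointer I) (toℕ-fromℕ k))
          (subst (_≤ lastCost σ) cutOff (∑-pick (crossing σ ∘ lastEdge) zₖ))
    where
    zₖ = pointer I (toℕ (fromℕ k))
    cutOff : crossing σ (lastEdge zₖ) ≡ toℕ zₖ
    cutOff rewrite reached | σt = refl

  -- A cut that cuts the source edge already pays more than minWeight.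
  sourceCost : ∀ σ → σ s ≡ true → σ (v fzero fzero) ≡ false → crossing σ sourceEdge ≡ B ^ suc k
  sourceCost σ σs σv rewrite σs | σv = sourceWeight

  minWeight-lower : ∀ S → minWeight ≤ cutWeight (graph k n I) S
  -- Either the source edge is cut, or z_0 = v^0_1 is on the s side and the path-cost lemma applies.
  minWeight-lower S = byFirstVertex (σ (v fzero fzero)) refl
    where
    open ≤-Reasoning
    σ = side S
    byFirstVertex : ∀ b → σ (v fzero fzero) ≡ b → minWeight ≤ cutWeight (graph k n I) S
    byFirstVertex true r₀ = begin
      minWeight                         ≤⟨ path-cost (n + 1) digit (stageCost σ) (σ ∘ pathVertex) _ (lastCost σ)
                                             digit≤ lastDigit≤ (λ j → stage-lower σ j (t-side S))
                                             (lastCost-lower σ (t-side S)) r₀ ⟩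
      ∑ (stageCost σ) + lastCost σ      ≤⟨ m≤n+m _ (crossing σ sourceEdge) ⟩
      crossing σ sourceEdge + (∑ (stageCost σ) + lastCost σ) ≡⟨ cutWeight-decomposition S ⟨
      cutWeight (graph k n I) S         ∎
    byFirstVertex false r₀ = <⇒≤ $ begin-strict
      minWeight                         <⟨ positional-< (n + 1) digit _ digit≤ lastDigit≤ ⟩
      B ^ suc k                         ≡⟨ sourceCost σ (s-side S) r₀ ⟨
      crossing σ sourceEdge             ≤⟨ m≤m+n _ _ ⟩
      crossing σ sourceEdge + (∑ (stageCost σ) + lastCost σ) ≡⟨ cutWeight-decomposition S ⟨
      cutWeight (graph k n I) S         ∎

  canonical : Vtx k N → Bool
  canonical s       = true
  canonical t       = false
  canonical (v j i) = does (i ≟ᶠ pointer I (toℕ j))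

  canonicalCut : Cut (Vtx k N) s t
  canonicalCut = record { side = canonical ; s-side = refl ; t-side = refl }

  -- In the canonical cut each vertex of layer j+1 pays w_{j+1} iff z_j has an edge to it:
  -- z_{j+1} through its sink edge, the others through their (single) in-edge.
  vertexCost-canonical : ∀ j i′ → let z = pointer I (toℕ j) in
    vertexCost canonical j z i′ ≡ wt k N (suc (toℕ j)) * covered (Out₁ j z) (Out₂ j z) i′
  vertexCost-canonical j i′
    rewrite toℕ-inject₁ j | dec-true (pointer I (toℕ j) ≟ᶠ pointer I (toℕ j)) refl
    with i′ ≟ᶠ target j (pointer I (toℕ j))
  ... | yes refl
      rewrite TwoSetsMeetingInOnePoint.covered-target (Out∩ j (pointer I (toℕ j)))
            | TwoSetsMeetingInOnePoint.multiplicity-target (Out∩ j (pointer I (toℕ j))) =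
    trans (+-identityʳ w) (sym (*-identityʳ w))
    where w = wt k N (suc (toℕ j))
  ... | no i′≢z′
      rewrite TwoSetsMeetingInOnePoint.multiplicity-off-target (Out∩ j (pointer I (toℕ j))) i′ i′≢z′ =
    *-comm _ (wt k N (suc (toℕ j)))

  rowCost-canonical-off : ∀ j i → i ≢ pointer I (toℕ j) → rowCost canonical j i ≡ 0
  rowCost-canonical-off j i i≢z = ∑-zero edgeFree
    where
    edgeFree : ∀ i′ → multiplicity (Out₁ j i) (Out₂ j i) i′ * crossing canonical (layerEdge j i i′) ≡ 0
    edgeFree i′ rewrite toℕ-inject₁ j | dec-false (i ≟ᶠ pointer I (toℕ j)) i≢z =
      *-zeroʳ (multiplicity (Out₁ j i) (Out₂ j i) i′)

  stage-canonical : ∀ j → stageCost canonical j ≡ B ^ (k ∸ toℕ j) * digit j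
  stage-canonical j = begin
    sinkCost canonical j + ∑ (rowCost canonical j)
      ≡⟨ cong (sinkCost canonical j +_) (∑-single (rowCost canonical j) z (rowCost-canonical-off j)) ⟩
    sinkCost canonical j + rowCost canonical j z      ≡⟨ sinkCost+rowCost canonical j z ⟩
    ∑[ i′ < N ] vertexCost canonical j z i′          ≡⟨ sum-cong-≗ (vertexCost-canonical j) ⟩
    ∑[ i′ < N ] (w * covered (Out₁ j z) (Out₂ j z) i′) ≡⟨ *-distribˡ-sum w (covered (Out₁ j z) (Out₂ j z)) ⟨
    w * digit j                                       ≡⟨ cong (_* digit j) (layerWeight (toℕ j)) ⟩
    B ^ (k ∸ toℕ j) * digit j                         ∎
    where
    open ≡-Reasoning
    z = pointer I (toℕ j)
    w = wt k N (suc (toℕ j))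

  lastCost-canonical : lastCost canonical ≡ toℕ (pointer I k)
  lastCost-canonical = begin
    lastCost canonical                 ≡⟨ ∑-single (crossing canonical ∘ lastEdge) zₖ offPath ⟩
    crossing canonical (lastEdge zₖ)   ≡⟨ onPath ⟩
    toℕ zₖ                             ≡⟨ cong (toℕ ∘ pointer I) (toℕ-fromℕ k) ⟩
    toℕ (pointer I k)                  ∎
    where
    open ≡-Reasoning
    zₖ = pointer I (toℕ (fromℕ k))
    offPath : ∀ i → i ≢ zₖ → crossing canonical (lastEdge i) ≡ 0
    offPath i i≢zₖ rewrite dec-false (i ≟ᶠ zₖ) i≢zₖ = refl
    onPath : crossing canonical (lastEdge zₖ) ≡ toℕ zₖ
    onPath rewrite dec-true (zₖ ≟ᶠ zₖ) refl = refl

  canonical-weight : cutWeight (graph k n I) canonicalCut ≡ minWeight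
  canonical-weight = begin
    cutWeight (graph k n I) canonicalCut
      ≡⟨ cutWeight-decomposition canonicalCut ⟩
    ∑ (stageCost canonical) + lastCost canonical
      ≡⟨ cong₂ _+_ (sum-cong-≗ stage-canonical) lastCost-canonical ⟩
    ∑[ j < k ] (B ^ (k ∸ toℕ j) * digit j) + toℕ (pointer I k)
      ≡⟨ positional-∑ B digit (toℕ (pointer I k)) ⟩
    minWeight ∎
    where open ≡-Reasoning

lemma6p3 : (k n : ℕ) → 1 ≤ k → (I : HPC (suc n)) → (w* : ℕ) →
    IsMinCutWeight (graph k n I) s t w* →
    toℕ (pointer I k) + 1 ≡ (w* % (suc n + 1)) + 1
lemma6p3 k n _ I w* ((S₀ , S₀-weight) , minimal) = cong (_+ 1) (begin
  toℕ (pointer I k)           ≡⟨ m≤n⇒m%n≡m lastDigit≤ ⟨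
  toℕ (pointer I k) % B       ≡⟨ positional-mod B digit (toℕ (pointer I k)) ⟨
  minWeight % B               ≡⟨ cong (_% B) w*≡minWeight ⟨
  w* % B                      ∎)
  where
  open ≡-Reasoning
  open Cuts k n I
  w*≡minWeight : w* ≡ minWeight
  w*≡minWeight = ≤-antisym (≤-trans (minimal canonicalCut) (≤-reflexive canonical-weight))
                           (subst (minWeight ≤_) S₀-weight (minWeight-lower S₀))
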